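{- Let $A$ be a finite abelian group and let $a,b\in A$ satisfy $2a\notin\langle b\rangle$ and $2b\notin\langle a\rangle$. Then there exists a cycle in the K\"ohler graph of $A$ containing the edge $[a,b,a+b]$.
   Context: For a finite abelian group $A$ (additive), $\hat A$ is the permutation group on $A$ generated by translations $x\mapsto x+a$ and $x\mapsto -x$; $[a_1,\dots,a_t]$ denotes the $\hat A$-orbit $\{\{0,a_1,\dots,a_t\}+c\}_{c\in A}\cup\{ -\{0,a_1,\dots,a_t\}+c\}_{c\in A}$. Let $\mathcal T=\{[a,b]: a,b\in A,\ a\ne\pm b,\ 2a\notin\{0,b,2b\},\ 2b\notin\{0,a,2a\}\}$ and $\mathcal E=\{[a,b,a+b]: a,b\in A,\ 0\notin\{2a,2b\},\ \{\pm a,\pm 2a\}\cap\{\pm b,\pm 2b\}=\emptyset\}$. The K\"ohler graph of $A$ has vertex set $\mathcal T$ and edge set $\mathcal E$, the orbit of a triple $T$ being incident with the orbit of a quadruple $B$ if $B\supseteq T'$ for some $T'$ in the orbit of $T$; each edge is incident with exactly two vertices. -}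

module Defs where

open import Level using (0ℓ)
open import Algebra.Structures using (IsAbelianGroup)
open import Relation.Binary.PropositionalEquality using (_≡_; _≢_)
open import Relation.Nullary using (¬_; yes; no)
open import Data.Nat as ℕ using (ℕ; zero; suc; _≤_)
open import Data.Fin using (Fin; zero; suc; toℕ; lower₁)
open import Data.Integer using (ℤ; +_; -[1+_])
open import Data.List using (List; []; _∷_; map)
open import Data.List.Membership.Propositional using (_∈_; _∉_)
open import Data.Product using (Σ; ∃; _×_)
open import Data.Sum using (_⊎_)
open import Function.Bundles using (_↔_)

record FiniteAbelianGroup : Set₁ where
  infixl 6 _+_
  infix  8 -_
  field
    Carrier        : Set
    _+_            : Carrier → Carrier → Carrier
    0#             : Carrier
    -_             : Carrier → Carrier
    isAbelianGroup : IsAbelianGroup _≡_ _+_ 0# -_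
    size           : ℕ
    enumeration    : Carrier ↔ Fin size

-- cyclic successor on Fin n (the last index wraps around to zero)
next : ∀ {n} → Fin n → Fin n
next {suc n} i with n ℕ.≟ toℕ i
... | yes _ = zero
... | no ne = suc (lower₁ i ne)

module _ (G : FiniteAbelianGroup) where
  open FiniteAbelianGroup G

  -- finite subsets of A are represented by lists; set equality / inclusion
  _≐_ : List Carrier → List Carrier → Set
  S ≐ T = ∀ x → (x ∈ S → x ∈ T) × (x ∈ T → x ∈ S)

  _⊆ₛ_ : List Carrier → List Carrier → Set
  S ⊆ₛ T = ∀ x → x ∈ S → x ∈ T

  -- the elements of Â: x ↦ x + c and x ↦ -x + c
  translate : Carrier → List Carrier → List Carrier
  translate c S = map (λ x → x + c) S

  reflectTranslate : Carrier → List Carrier → List Carrier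
  reflectTranslate c S = map (λ x → - x + c) S

  InOrbit : List Carrier → List Carrier → Set
  InOrbit S T = ∃ λ c → (T ≐ translate c S) ⊎ (T ≐ reflectTranslate c S)

  double : Carrier → Carrier
  double x = x + x

  _×ₙ_ : ℕ → Carrier → Carrier
  zero  ×ₙ x = 0#
  suc n ×ₙ x = x + (n ×ₙ x)

  _·_ : ℤ → Carrier → Carrier
  (+ n)    · x = n ×ₙ x
  -[1+ n ] · x = - (suc n ×ₙ x)

  InCyclic : Carrier → Carrier → Set
  InCyclic b x = ∃ λ (z : ℤ) → x ≡ z · b

  base : List Carrier → List Carrier
  base as = 0# ∷ as

  IsVertexPair : Carrier → Carrier → Set
  IsVertexPair a b =
    a ≢ b × a ≢ - b
    × double a ∉ (0# ∷ b ∷ double b ∷ [])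
    × double b ∉ (0# ∷ a ∷ double a ∷ [])

  IsEdgePair : Carrier → Carrier → Set
  IsEdgePair a b =
    double a ≢ 0# × double b ≢ 0#
    × (∀ x → x ∈ (a ∷ - a ∷ double a ∷ - double a ∷ [])
           → x ∉ (b ∷ - b ∷ double b ∷ - double b ∷ []))

  -- a vertex [a,b] (represented by a,b; identified up to orbit)
  record Vertex : Set where
    constructor vertex
    field
      va va' : Carrier
      isVertex : IsVertexPair va va'

  record Edge : Set where
    constructor edge
    field
      ea ea' : Carrier
      isEdge : IsEdgePair ea ea'

  vset : Vertex → List Carrier
  vset (vertex a b _) = base (a ∷ b ∷ [])

  eset : Edge → List Carrier
  eset (edge a b _) = base (a ∷ b ∷ a + b ∷ [])

  SameVertex : Vertex → Vertex → Set
  SameVertex v w = InOrbit (vset v) (vset w)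

  SameEdge : Edge → Edge → Set
  SameEdge e f = InOrbit (eset e) (eset f)

  Incident : Vertex → Edge → Set
  Incident v e = ∃ λ T' → InOrbit (vset v) T' × T' ⊆ₛ eset e

  record Cycle : Set where
    field
      len          : ℕ
      len≥2        : 2 ≤ len
      vtx          : Fin len → Vertex
      edg          : Fin len → Edge
      vtx-distinct : ∀ i j → i ≢ j → ¬ SameVertex (vtx i) (vtx j)
      edg-distinct : ∀ i j → i ≢ j → ¬ SameEdge (edg i) (edg j)
      edg-left     : ∀ i → Incident (vtx i) (edg i)
      edg-right    : ∀ i → Incident (vtx (next i)) (edg i)

  CycleContains : Cycle → Carrier → Carrier → Set
  CycleContains C a b =
    ∃ λ i → InOrbit (eset (Cycle.edg C i)) (base (a ∷ b ∷ a + b ∷ []))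

-- Let n be the order of a and cₖ = k·a + b.  The vertices [a, cₖ] and the edges
-- [a, cₖ, a + cₖ] for k < n form a cycle of length n ≥ 2 through [a, b, a + b],
-- because a + cₖ = cₖ₊₁ with indices taken mod n.  They are vertices and edges
-- since ±a, ±2a lie in ⟨a⟩ while 2b ∉ ⟨a⟩ keeps ±cₖ, ±2cₖ out of it.  If two of
-- them lay in one Â-orbit, some x would give {0, a, cⱼ} ⊆ x ± {0, a, cᵢ}; each way
-- of matching the elements yields integer relations among a, cᵢ, cⱼ and x, and in
-- every case two of them differ by a relation p·a + q·cᵢ + r·cⱼ = 0 contradicting
-- 2a ∉ ⟨b⟩, 2b ∉ ⟨a⟩ or i ≢ j.  That finite case analysis is decided by
-- evaluating a certificate.

module Submission where

open import Algebra.Bundles using (AbelianGroup)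
import Algebra.Properties.AbelianGroup as AbelianGroupProperties
import Algebra.Properties.CommutativeSemigroup as CommutativeSemigroupProperties
import Algebra.Properties.Group as GroupProperties
open import Algebra.Structures using (IsAbelianGroup)
open import Data.Bool using (Bool; T)
open import Data.Bool.ListAction using (all; any)
open import Data.Empty using (⊥-elim)
open import Data.Fin using (Fin; zero; suc; toℕ; fromℕ<)
import Data.Fin.Properties as Fin
open import Data.Integer as ℤ using (ℤ; -[1+_]) renaming (+_ to pos)
import Data.Integer.Properties as ℤ
open import Data.List as List using (List; []; _∷_)
open import Data.List.Membership.Propositional.Properties using (∈-map⁻; ∈-++⁺ˡ)
import Data.List.Properties as List
open import Data.List.Relation.Unary.All as All using (All; []; _∷_; lookupAny)
import Data.List.Relation.Unary.All.Properties as All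
open import Data.List.Relation.Unary.Any as Any using (here; there)
import Data.List.Relation.Unary.Any.Properties as Any
open import Data.Maybe as Maybe using (Maybe; just; nothing; is-just; to-witness-T)
open import Data.Nat as ℕ using (ℕ; zero; suc)
open import Data.Nat.Induction using (<-rec)
import Data.Nat.Properties as ℕ
open import Data.Product using (Σ; _,_; ∃; _×_; proj₁; proj₂)
open import Data.Sum using (_⊎_; inj₁; inj₂)
open import Data.Vec as Vec using (Vec; []; _∷_; lookup; replicate; zipWith; _[_]≔_)
open import Function using (_∘_)
open import Function.Bundles using (Injection)
open import Function.Properties.Inverse using (↔⇒↣)
open import Level using (0ℓ)
open import Relation.Binary.Definitions using (DecidableEquality; tri<; tri≈; tri>)
open import Relation.Binary.PropositionalEquality
open import Relation.Nullary using (¬_; yes; no)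
open import Relation.Nullary.Decidable using (_×-dec_)
import Relation.Unary as U

open import Defs hiding (_×ₙ_; _·_)
import Defs

data AbsOneOrTwo : ℤ → Set where
  one       : AbsOneOrTwo (pos 1)
  two       : AbsOneOrTwo (pos 2)
  minus-one : AbsOneOrTwo -[1+ 0 ]
  minus-two : AbsOneOrTwo -[1+ 1 ]

module Multiples (G : FiniteAbelianGroup) where
  open FiniteAbelianGroup G

  _×ₙ_ : ℕ → Carrier → Carrier
  _×ₙ_ = Defs._×ₙ_ G

  _·_ : ℤ → Carrier → Carrier
  _·_ = Defs._·_ G

  abelianGroup : AbelianGroup 0ℓ 0ℓ
  abelianGroup = record { isAbelianGroup = isAbelianGroup }

  open IsAbelianGroup isAbelianGroup
    using (assoc; identityˡ; identityʳ; inverseˡ; inverseʳ)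
  open GroupProperties (AbelianGroup.group abelianGroup)
    using (⁻¹-involutive; ε⁻¹≈ε; \\-leftDividesʳ; ∙-cancelʳ)
  open AbelianGroupProperties abelianGroup using (⁻¹-∙-comm)
  open CommutativeSemigroupProperties (AbelianGroup.commutativeSemigroup abelianGroup)
    using (interchange)
  open ≡-Reasoning

  ×ₙ-homo-+ : ∀ m n x → (m ℕ.+ n) ×ₙ x ≡ m ×ₙ x + n ×ₙ x
  ×ₙ-homo-+ zero    n x = sym (identityˡ _)
  ×ₙ-homo-+ (suc m) n x = trans (cong (x +_) (×ₙ-homo-+ m n x)) (sym (assoc _ _ _))

  ×ₙ-distrib-+ : ∀ n x y → n ×ₙ (x + y) ≡ n ×ₙ x + n ×ₙ y
  ×ₙ-distrib-+ zero    x y = sym (identityˡ _)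
  ×ₙ-distrib-+ (suc n) x y = trans (cong ((x + y) +_) (×ₙ-distrib-+ n x y)) (interchange _ _ _ _)

  ×ₙ-∸-annihilates : ∀ {k j} x → k ℕ.≤ j → k ×ₙ x ≡ j ×ₙ x → (j ℕ.∸ k) ×ₙ x ≡ 0#
  ×ₙ-∸-annihilates {k} {j} x k≤j kx≡jx = ∙-cancelʳ (k ×ₙ x) _ _ (begin
    (j ℕ.∸ k) ×ₙ x + k ×ₙ x   ≡⟨ ×ₙ-homo-+ (j ℕ.∸ k) k x ⟨
    (j ℕ.∸ k ℕ.+ k) ×ₙ x      ≡⟨ cong (_×ₙ x) (ℕ.m∸n+n≡m k≤j) ⟩
    j ×ₙ x                    ≡⟨ kx≡jx ⟨
    k ×ₙ x                    ≡⟨ identityˡ _ ⟨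
    0# + k ×ₙ x               ∎)

  ·-homo-neg : ∀ i x → (ℤ.- i) · x ≡ - (i · x)
  ·-homo-neg (pos zero)    x = sym ε⁻¹≈ε
  ·-homo-neg (pos (suc n)) x = refl
  ·-homo-neg -[1+ n ]     x = sym (⁻¹-involutive _)

  ·-suc : ∀ i x → ℤ.suc i · x ≡ x + i · x
  ·-suc (pos n)        x = refl
  ·-suc -[1+ zero ]    x = sym (trans (cong (λ y → x + - y) (identityʳ x)) (inverseʳ x))
  ·-suc -[1+ suc n ]   x = begin
    ℤ.suc -[1+ suc n ] · x         ≡⟨ cong (_· x) (ℤ.suc-pred -[1+ n ]) ⟩
    - (suc n ×ₙ x)                 ≡⟨ identityˡ _ ⟨
    0# + - (suc n ×ₙ x)            ≡⟨ cong (_+ - (suc n ×ₙ x)) (inverseʳ x) ⟨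
    (x + - x) + - (suc n ×ₙ x)     ≡⟨ assoc _ _ _ ⟩
    x + (- x + - (suc n ×ₙ x))     ≡⟨ cong (x +_) (⁻¹-∙-comm _ _) ⟩
    x + -[1+ suc n ] · x           ∎

  ·-pred : ∀ i x → ℤ.pred i · x ≡ - x + i · x
  ·-pred i x = begin
    ℤ.pred i · x                   ≡⟨ identityˡ _ ⟨
    0# + ℤ.pred i · x              ≡⟨ cong (_+ ℤ.pred i · x) (inverseˡ x) ⟨
    (- x + x) + ℤ.pred i · x       ≡⟨ assoc _ _ _ ⟩
    - x + (x + ℤ.pred i · x)       ≡⟨ cong (- x +_) (·-suc (ℤ.pred i) x) ⟨
    - x + ℤ.suc (ℤ.pred i) · x     ≡⟨ cong (λ k → - x + k · x) (ℤ.suc-pred i) ⟩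
    - x + i · x                    ∎

  ·-homo-+ : ∀ i j x → (i ℤ.+ j) · x ≡ i · x + j · x
  ·-homo-+ (pos zero)    j x = trans (cong (_· x) (ℤ.+-identityˡ j)) (sym (identityˡ _))
  ·-homo-+ (pos (suc m)) j x = begin
    (pos (suc m) ℤ.+ j) · x           ≡⟨ cong (_· x) (ℤ.suc-+ m j) ⟩
    ℤ.suc (pos m ℤ.+ j) · x           ≡⟨ ·-suc (pos m ℤ.+ j) x ⟩
    x + (pos m ℤ.+ j) · x             ≡⟨ cong (x +_) (·-homo-+ (pos m) j x) ⟩
    x + (m ×ₙ x + j · x)              ≡⟨ assoc _ _ _ ⟨
    (x + m ×ₙ x) + j · x              ∎
  ·-homo-+ -[1+ zero ]   j x =
    trans (·-pred j x) (cong (λ y → - y + j · x) (sym (identityʳ x)))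
  ·-homo-+ -[1+ suc m ]  j x = begin
    (-[1+ suc m ] ℤ.+ j) · x          ≡⟨ cong (_· x) (ℤ.pred-+ -[1+ m ] j) ⟩
    ℤ.pred (-[1+ m ] ℤ.+ j) · x       ≡⟨ ·-pred (-[1+ m ] ℤ.+ j) x ⟩
    - x + (-[1+ m ] ℤ.+ j) · x        ≡⟨ cong (- x +_) (·-homo-+ -[1+ m ] j x) ⟩
    - x + (-[1+ m ] · x + j · x)      ≡⟨ assoc _ _ _ ⟨
    (- x + - (suc m ×ₙ x)) + j · x    ≡⟨ cong (_+ j · x) (⁻¹-∙-comm _ _) ⟩
    -[1+ suc m ] · x + j · x          ∎

  ·-distrib-+ : ∀ i x y → i · (x + y) ≡ i · x + i · y
  ·-distrib-+ (pos n)  x y = ×ₙ-distrib-+ n x y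
  ·-distrib-+ -[1+ n ] x y = trans (cong -_ (×ₙ-distrib-+ (suc n) x y)) (sym (⁻¹-∙-comm _ _))

  ×ₙ-·-assoc : ∀ m j x → m ×ₙ (j · x) ≡ (pos m ℤ.* j) · x
  ×ₙ-·-assoc zero    j x = cong (_· x) (sym (ℤ.*-zeroˡ j))
  ×ₙ-·-assoc (suc m) j x = begin
    j · x + m ×ₙ (j · x)           ≡⟨ cong (j · x +_) (×ₙ-·-assoc m j x) ⟩
    j · x + (pos m ℤ.* j) · x      ≡⟨ ·-homo-+ j (pos m ℤ.* j) x ⟨
    (j ℤ.+ pos m ℤ.* j) · x        ≡⟨ cong (_· x) (ℤ.suc-* (pos m) j) ⟨
    (pos (suc m) ℤ.* j) · x        ∎

  ·-assoc : ∀ i j x → i · (j · x) ≡ (i ℤ.* j) · x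
  ·-assoc (pos m)  j x = ×ₙ-·-assoc m j x
  ·-assoc -[1+ m ] j x = begin
    - (suc m ×ₙ (j · x))           ≡⟨ cong -_ (×ₙ-·-assoc (suc m) j x) ⟩
    - ((pos (suc m) ℤ.* j) · x)    ≡⟨ ·-homo-neg (pos (suc m) ℤ.* j) x ⟨
    (ℤ.- (pos (suc m) ℤ.* j)) · x  ≡⟨ cong (_· x) (ℤ.neg-distribˡ-* (pos (suc m)) j) ⟩
    (-[1+ m ] ℤ.* j) · x           ∎

  InCyclic-0 : ∀ x → InCyclic G x 0#
  InCyclic-0 x = pos 0 , refl

  InCyclic-×ₙ : ∀ k x → InCyclic G x (k ×ₙ x)
  InCyclic-×ₙ k x = pos k , refl

  InCyclic-self : ∀ x → InCyclic G x x
  InCyclic-self x = pos 1 , sym (identityʳ x)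

  InCyclic-+ : ∀ {x y z} → InCyclic G x y → InCyclic G x z → InCyclic G x (y + z)
  InCyclic-+ {x} (i , y≡ix) (j , z≡jx) =
    i ℤ.+ j , trans (cong₂ _+_ y≡ix z≡jx) (sym (·-homo-+ i j x))

  InCyclic-neg : ∀ {x y} → InCyclic G x y → InCyclic G x (- y)
  InCyclic-neg {x} (i , y≡ix) = ℤ.- i , trans (cong -_ y≡ix) (sym (·-homo-neg i x))

  InCyclic-neg⁻ : ∀ {x y} → InCyclic G x (- y) → InCyclic G x y
  InCyclic-neg⁻ h = subst (InCyclic G _) (⁻¹-involutive _) (InCyclic-neg h)

  InCyclic-· : ∀ {x y} i → InCyclic G x y → InCyclic G x (i · y)
  InCyclic-· {x} i (j , y≡jx) = i ℤ.* j , trans (cong (i ·_) y≡jx) (·-assoc i j x)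

  InCyclic-cancelˡ : ∀ {x y z} → InCyclic G x y → InCyclic G x (y + z) → InCyclic G x z
  InCyclic-cancelˡ {y = y} {z} y∈ y+z∈ =
    subst (InCyclic G _) (\\-leftDividesʳ y z) (InCyclic-+ (InCyclic-neg y∈) y+z∈)

  InCyclic-double : ∀ {w x y} → AbsOneOrTwo w → InCyclic G x (w · y) → InCyclic G x (y + y)
  InCyclic-double {y = y} one       h = InCyclic-+ y∈ y∈
    where y∈ = subst (InCyclic G _) (identityʳ y) h
  InCyclic-double {y = y} two       h = subst (InCyclic G _) (cong (y +_) (identityʳ y)) h
  InCyclic-double minus-one h = InCyclic-double one (InCyclic-neg⁻ h)
  InCyclic-double minus-two h = InCyclic-double two (InCyclic-neg⁻ h)

data Term (n : ℕ) : Set where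
  var  : Fin n → Term n
  0ₜ   : Term n
  _+ₜ_ : Term n → Term n → Term n
  -ₜ_  : Term n → Term n

infixl 6 _+ₜ_ _+ᵥ_ _-ᵥ_
infix  8 -ₜ_ -ᵥ_

_+ᵥ_ : ∀ {n} → Vec ℤ n → Vec ℤ n → Vec ℤ n
_+ᵥ_ = zipWith ℤ._+_

-ᵥ_ : ∀ {n} → Vec ℤ n → Vec ℤ n
-ᵥ_ = Vec.map (λ z → ℤ.- z)

_-ᵥ_ : ∀ {n} → Vec ℤ n → Vec ℤ n → Vec ℤ n
u -ᵥ v = u +ᵥ -ᵥ v

basis : ∀ {n} → Fin n → Vec ℤ n
basis i = replicate _ (pos 0) [ i ]≔ pos 1

coefficients : ∀ {n} → Term n → Vec ℤ n
coefficients (var i)  = basis i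
coefficients 0ₜ       = replicate _ (pos 0)
coefficients (s +ₜ t) = coefficients s +ᵥ coefficients t
coefficients (-ₜ s)   = -ᵥ coefficients s

module Combinations (G : FiniteAbelianGroup) where
  open FiniteAbelianGroup G
  open Multiples G
  open IsAbelianGroup isAbelianGroup using (identityˡ; identityʳ; inverseʳ)
  open GroupProperties (AbelianGroup.group abelianGroup) using (ε⁻¹≈ε)
  open AbelianGroupProperties abelianGroup using (⁻¹-∙-comm)
  open CommutativeSemigroupProperties (AbelianGroup.commutativeSemigroup abelianGroup)
    using (interchange)

  combination : ∀ {n} → Vec ℤ n → Vec Carrier n → Carrier
  combination []       []       = 0#
  combination (z ∷ zs) (g ∷ gs) = z · g + combination zs gs

  combination-zero : ∀ {n} (gs : Vec Carrier n) → combination (replicate n (pos 0)) gs ≡ 0#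
  combination-zero []       = refl
  combination-zero (g ∷ gs) = trans (identityˡ _) (combination-zero gs)

  combination-basis : ∀ {n} i (gs : Vec Carrier n) → combination (basis i) gs ≡ lookup gs i
  combination-basis zero    (g ∷ gs) =
    trans (cong₂ _+_ (identityʳ g) (combination-zero gs)) (identityʳ g)
  combination-basis (suc i) (g ∷ gs) = trans (identityˡ _) (combination-basis i gs)

  combination-homo-+ : ∀ {n} (u v : Vec ℤ n) gs →
    combination (u +ᵥ v) gs ≡ combination u gs + combination v gs
  combination-homo-+ []      []      []       = sym (identityʳ 0#)
  combination-homo-+ (y ∷ u) (z ∷ v) (g ∷ gs) =
    trans (cong₂ _+_ (·-homo-+ y z g) (combination-homo-+ u v gs)) (interchange _ _ _ _)

  combination-homo-neg : ∀ {n} (u : Vec ℤ n) gs → combination (-ᵥ u) gs ≡ - combination u gs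
  combination-homo-neg []      []       = sym ε⁻¹≈ε
  combination-homo-neg (z ∷ u) (g ∷ gs) =
    trans (cong₂ _+_ (·-homo-neg z g) (combination-homo-neg u gs)) (⁻¹-∙-comm _ _)

  combination-homo-sub : ∀ {n} (u v : Vec ℤ n) gs →
    combination (u -ᵥ v) gs ≡ combination u gs + - combination v gs
  combination-homo-sub u v gs =
    trans (combination-homo-+ u (-ᵥ v) gs) (cong (combination u gs +_) (combination-homo-neg v gs))

  combination-≡⇒difference≡0 : ∀ {n} (u v : Vec ℤ n) gs →
    combination u gs ≡ combination v gs → combination (u -ᵥ v) gs ≡ 0#
  combination-≡⇒difference≡0 u v gs u≡v =
    trans (combination-homo-sub u v gs) (trans (cong (λ x → x + - combination v gs) u≡v) (inverseʳ _))

  module Evaluation {n} (gens : Vec Carrier n) where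

    Vanishes : Vec ℤ n → Set
    Vanishes v = combination v gens ≡ 0#

    evaluate : Term n → Carrier
    evaluate (var i)  = lookup gens i
    evaluate 0ₜ       = 0#
    evaluate (s +ₜ t) = evaluate s + evaluate t
    evaluate (-ₜ s)   = - evaluate s

    coefficients-sound : ∀ s → combination (coefficients s) gens ≡ evaluate s
    coefficients-sound (var i)  = combination-basis i gens
    coefficients-sound 0ₜ       = combination-zero gens
    coefficients-sound (s +ₜ t) = trans (combination-homo-+ (coefficients s) (coefficients t) gens)
                                        (cong₂ _+_ (coefficients-sound s) (coefficients-sound t))
    coefficients-sound (-ₜ s)   =
      trans (combination-homo-neg (coefficients s) gens) (cong -_ (coefficients-sound s))

    difference-vanishes : ∀ u v → Vanishes u → Vanishes v → Vanishes (u -ᵥ v)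
    difference-vanishes u v u≡0 v≡0 = combination-≡⇒difference≡0 u v gens (trans u≡0 (sym v≡0))

    relation-of-≡ : ∀ s t → evaluate s ≡ evaluate t → Vanishes (coefficients s -ᵥ coefficients t)
    relation-of-≡ s t s≡t = combination-≡⇒difference≡0 (coefficients s) (coefficients t) gens
      (trans (coefficients-sound s) (trans s≡t (sym (coefficients-sound t))))

  module Certificates {n} (gens : Vec Carrier n)
    {Impossible : Vec ℤ n → Set}
    (impossible? : ∀ v → Maybe (Impossible v))
    (impossible-sound : ∀ {v} → Impossible v → combination v gens ≢ 0#) where
    open Evaluation gens

    refutes : Vec ℤ n → Bool
    refutes v = is-just (impossible? v)

    refutes-sound : ∀ v → T (refutes v) → ¬ Vanishes v
    refutes-sound v h = impossible-sound (to-witness-T (impossible? v) h)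

    refutesSomeDifference : List (Vec ℤ n) → Bool
    refutesSomeDifference rels = any (λ u → any (λ v → refutes (u -ᵥ v)) rels) rels

    refutesSomeDifference-sound : ∀ rels → All Vanishes rels → ¬ T (refutesSomeDifference rels)
    refutesSomeDifference-sound rels vanish h =
      let u∈ = Any.any⁻ _ rels h
          u≡0 , h′ = lookupAny vanish u∈
          v∈ = Any.any⁻ _ rels h′
          v≡0 , refuted = lookupAny vanish v∈
      in refutes-sound _ refuted (difference-vanishes (Any.lookup u∈) (Any.lookup v∈) u≡0 v≡0)

    -- Branches over the element of rs that each element of ls equals.
    refutes-⊆ : List (Vec ℤ n) → List (Term n) → List (Term n) → Bool
    refutes-⊆ rels []       rs = refutesSomeDifference rels
    refutes-⊆ rels (l ∷ ls) rs =
      all (λ r → refutes-⊆ ((coefficients l -ᵥ coefficients r) ∷ rels) ls rs) rs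

    refutes-⊆-sound : ∀ rels ls rs → All Vanishes rels → T (refutes-⊆ rels ls rs) →
      ¬ (_⊆ₛ_ G (List.map evaluate ls) (List.map evaluate rs))
    refutes-⊆-sound rels []       rs vanish h _ = refutesSomeDifference-sound rels vanish h
    refutes-⊆-sound rels (l ∷ ls) rs vanish h ls⊆rs
      with ∈-map⁻ evaluate (ls⊆rs _ (here refl))
    ... | r , r∈rs , l≡r =
      refutes-⊆-sound _ ls rs (relation-of-≡ l r l≡r ∷ vanish)
        (All.lookup (All.all⁺ _ rs h) r∈rs) (λ x x∈ → ls⊆rs x (there x∈))

    ⊈-by-certificate : ∀ ls rs → T (refutes-⊆ [] ls rs) →
      ¬ (_⊆ₛ_ G (List.map evaluate ls) (List.map evaluate rs))
    ⊈-by-certificate ls rs = refutes-⊆-sound [] ls rs []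

-- Coefficient vectors refer to the generators a, u + b, u′ + b, t of Impossibility.
data Impossible : Vec ℤ 4 → Set where
  b-coefficient : ∀ p q r → AbsOneOrTwo (q ℤ.+ r) → Impossible (p ∷ q ∷ r ∷ pos 0 ∷ [])
  a-coefficient : ∀ p → AbsOneOrTwo p → Impossible (p ∷ pos 0 ∷ pos 0 ∷ pos 0 ∷ [])
  cosets-differ : Impossible (pos 0 ∷ pos 1 ∷ -[1+ 0 ] ∷ pos 0 ∷ [])

absOneOrTwo? : ∀ z → Maybe (AbsOneOrTwo z)
absOneOrTwo? (pos 1)    = just one
absOneOrTwo? (pos 2)    = just two
absOneOrTwo? -[1+ 0 ]   = just minus-one
absOneOrTwo? -[1+ 1 ]   = just minus-two
absOneOrTwo? _          = nothing

impossible? : ∀ v → Maybe (Impossible v)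
impossible? (p ∷ q ∷ r ∷ pos 0 ∷ []) with absOneOrTwo? (q ℤ.+ r)
... | just w = just (b-coefficient p q r w)
impossible? (p ∷ pos 0 ∷ pos 0 ∷ pos 0 ∷ []) | nothing =
  Maybe.map (a-coefficient p) (absOneOrTwo? p)
impossible? (pos 0 ∷ pos 1 ∷ -[1+ 0 ] ∷ pos 0 ∷ []) | nothing = just cosets-differ
impossible? (_ ∷ _ ∷ _ ∷ pos 0 ∷ []) | nothing = nothing
impossible? _ = nothing

module Impossibility (G : FiniteAbelianGroup) (a b u u′ t : FiniteAbelianGroup.Carrier G)
  (2a∉⟨b⟩ : ¬ InCyclic G b (FiniteAbelianGroup._+_ G a a))
  (2b∉⟨a⟩ : ¬ InCyclic G a (FiniteAbelianGroup._+_ G b b))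
  (u∈⟨a⟩ : InCyclic G a u) (u′∈⟨a⟩ : InCyclic G a u′) (u≢u′ : u ≢ u′) where
  open FiniteAbelianGroup G
  open Multiples G
  open Combinations G
  open IsAbelianGroup isAbelianGroup using (identityˡ; identityʳ)
  open GroupProperties (AbelianGroup.group abelianGroup)
    using (inverseʳ-unique; x∙y⁻¹≈ε⇒x≈y; ∙-cancelʳ)
  open ≡-Reasoning

  generators : Vec Carrier 4
  generators = a ∷ u + b ∷ u′ + b ∷ t ∷ []

  separate-b : ∀ p q r →
    combination (p ∷ q ∷ r ∷ pos 0 ∷ []) generators ≡ (p · a + (q · u + r · u′)) + (q ℤ.+ r) · b
  separate-b p q r = begin
    p · a + (q · (u + b) + (r · (u′ + b) + (0# + 0#)))
      ≡⟨ cong₂ (λ x y → p · a + (x + (y + (0# + 0#)))) (·-distrib-+ q u b) (·-distrib-+ r u′ b) ⟩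
    p · a + ((q · u + q · b) + ((r · u′ + r · b) + (0# + 0#)))
      ≡⟨ rearrange (p · a) (q · u) (q · b) (r · u′) (r · b) ⟩
    (p · a + (q · u + r · u′)) + (q · b + r · b)
      ≡⟨ cong ((p · a + (q · u + r · u′)) +_) (·-homo-+ q r b) ⟨
    (p · a + (q · u + r · u′)) + (q ℤ.+ r) · b ∎
    where
    open import Algebra.Solver.CommutativeMonoid (AbelianGroup.commutativeMonoid abelianGroup)
      using (solve; _⊜_; _⊕_; id)
    rearrange : ∀ w x y z v → w + ((x + y) + ((z + v) + (0# + 0#))) ≡ (w + (x + z)) + (y + v)
    rearrange = solve 5 (λ w x y z v → w ⊕ ((x ⊕ y) ⊕ ((z ⊕ v) ⊕ (id ⊕ id)))
                                      ⊜ (w ⊕ (x ⊕ z)) ⊕ (y ⊕ v)) refl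

  impossible-sound : ∀ {v} → Impossible v → combination v generators ≢ 0#
  impossible-sound (b-coefficient p q r w) vanishes = 2b∉⟨a⟩ (InCyclic-double w (subst (InCyclic G a)
      (sym (inverseʳ-unique _ _ (trans (sym (separate-b p q r)) vanishes)))
      (InCyclic-neg (InCyclic-+ (InCyclic-· p (InCyclic-self a))
                                (InCyclic-+ (InCyclic-· q u∈⟨a⟩) (InCyclic-· r u′∈⟨a⟩))))))
  impossible-sound (a-coefficient p w) vanishes = 2a∉⟨b⟩ (InCyclic-double w (subst (InCyclic G b)
      (sym (trans (sym (trans (cong (p · a +_) zeros) (identityʳ _))) vanishes))
      (InCyclic-0 b)))
    where zeros = trans (identityˡ _) (trans (identityˡ _) (identityˡ 0#))
  impossible-sound cosets-differ vanishes =
    u≢u′ (∙-cancelʳ b u u′ (x∙y⁻¹≈ε⇒x≈y _ _ (trans (sym simplify) vanishes)))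
    where
    c = u + b
    c′ = u′ + b
    simplify : 0# + ((c + 0#) + (- (c′ + 0#) + (0# + 0#))) ≡ c + - c′
    simplify = trans (identityˡ _) (cong₂ _+_ (identityʳ c)
      (trans (cong (- (c′ + 0#) +_) (identityʳ 0#)) (trans (identityʳ _) (cong -_ (identityʳ c′)))))

module Validity (G : FiniteAbelianGroup) (a c : FiniteAbelianGroup.Carrier G)
  (2a≢0 : FiniteAbelianGroup._+_ G a a ≢ FiniteAbelianGroup.0# G)
  (2c∉⟨a⟩ : ¬ InCyclic G a (FiniteAbelianGroup._+_ G c c)) where
  open FiniteAbelianGroup G
  open Multiples G

  c∉⟨a⟩ : ¬ InCyclic G a c
  c∉⟨a⟩ c∈ = 2c∉⟨a⟩ (InCyclic-+ c∈ c∈)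

  multiples-of-c∉⟨a⟩ : All (λ x → ¬ InCyclic G a x) (c ∷ - c ∷ double G c ∷ - double G c ∷ [])
  multiples-of-c∉⟨a⟩ =
    c∉⟨a⟩ ∷ (c∉⟨a⟩ ∘ InCyclic-neg⁻) ∷ 2c∉⟨a⟩ ∷ (2c∉⟨a⟩ ∘ InCyclic-neg⁻) ∷ []

  2a∈⟨a⟩ : InCyclic G a (double G a)
  2a∈⟨a⟩ = InCyclic-+ (InCyclic-self a) (InCyclic-self a)

  multiples-of-a∈⟨a⟩ : All (InCyclic G a) (a ∷ - a ∷ double G a ∷ - double G a ∷ [])
  multiples-of-a∈⟨a⟩ =
    InCyclic-self a ∷ InCyclic-neg (InCyclic-self a) ∷ 2a∈⟨a⟩ ∷ InCyclic-neg 2a∈⟨a⟩ ∷ []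

  isVertexPair : IsVertexPair G a c
  isVertexPair =
      (λ a≡c → c∉⟨a⟩ (subst (InCyclic G a) a≡c (InCyclic-self a)))
    , (λ a≡-c → c∉⟨a⟩ (InCyclic-neg⁻ (subst (InCyclic G a) a≡-c (InCyclic-self a))))
    , (λ { (here 2a≡0)                 → 2a≢0 2a≡0
         ; (there (here 2a≡c))         → c∉⟨a⟩ (subst (InCyclic G a) 2a≡c 2a∈⟨a⟩)
         ; (there (there (here 2a≡2c))) → 2c∉⟨a⟩ (subst (InCyclic G a) 2a≡2c 2a∈⟨a⟩) })
    , (λ 2c∈ → 2c∉⟨a⟩ (All.lookup {P = InCyclic G a}
                          (InCyclic-0 a ∷ InCyclic-self a ∷ 2a∈⟨a⟩ ∷ []) 2c∈))

  isEdgePair : IsEdgePair G a c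
  isEdgePair =
      2a≢0
    , (λ 2c≡0 → 2c∉⟨a⟩ (subst (InCyclic G a) (sym 2c≡0) (InCyclic-0 a)))
    , (λ x x∈ x∈′ → All.lookup multiples-of-c∉⟨a⟩ x∈′ (All.lookup multiples-of-a∈⟨a⟩ x∈))

LeastWitness : (ℕ → Set) → Set
LeastWitness P = ∃ λ n → P n × (∀ {k} → k ℕ.< n → ¬ P k)

least-witness : ∀ {P : ℕ → Set} → U.Decidable P → ∀ m → P m → LeastWitness P
least-witness {P} P? = <-rec (λ m → P m → LeastWitness P) search
  where
  search : ∀ m → (∀ {k} → k ℕ.< m → P k → LeastWitness P) → P m → LeastWitness P
  search m smaller Pm with ℕ.anyUpTo? P? m
  ... | yes (k , k<m , Pk) = smaller k<m Pk
  ... | no none            = m , Pm , λ k<m Pk → none (_ , k<m , Pk)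

module Orbits (G : FiniteAbelianGroup) where
  open FiniteAbelianGroup G
  open IsAbelianGroup isAbelianGroup using (identityʳ)

  ≐-reflexive : ∀ {S T} → S ≡ T → _≐_ G S T
  ≐-reflexive refl x = (λ x∈ → x∈) , (λ x∈ → x∈)

  ≐⇒⊆ : ∀ {S T} → _≐_ G S T → _⊆ₛ_ G S T
  ≐⇒⊆ S≐T x = proj₁ (S≐T x)

  InOrbit-refl : ∀ S → InOrbit G S S
  InOrbit-refl S = 0# , inj₁ (≐-reflexive (sym (trans (List.map-cong identityʳ S) (List.map-id S))))

toℕ-next : ∀ {n} (i : Fin n) → toℕ (next i) ≡ suc (toℕ i) ⊎ (toℕ (next i) ≡ 0 × suc (toℕ i) ≡ n)
toℕ-next {suc n} i with n ℕ.≟ toℕ i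
... | yes n≡i = inj₂ (refl , cong suc (sym n≡i))
... | no  n≢i = inj₁ (cong suc (Fin.toℕ-lower₁ i n≢i))

module KöhlerCycle (G : FiniteAbelianGroup) (a b : FiniteAbelianGroup.Carrier G)
  (2a∉⟨b⟩ : ¬ InCyclic G b (FiniteAbelianGroup._+_ G a a))
  (2b∉⟨a⟩ : ¬ InCyclic G a (FiniteAbelianGroup._+_ G b b)) where
  open FiniteAbelianGroup G
  open Multiples G
  open Combinations G
  open Orbits G
  open IsAbelianGroup isAbelianGroup using (assoc; identityˡ; identityʳ)
  open CommutativeSemigroupProperties (AbelianGroup.commutativeSemigroup abelianGroup)
    using (interchange)

  encoding : Injection (setoid Carrier) (setoid (Fin size))
  encoding = ↔⇒↣ enumeration

  _≟_ : DecidableEquality Carrier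
  _≟_ = Fin.inj⇒≟ encoding

  2a≢0 : a + a ≢ 0#
  2a≢0 2a≡0 = 2a∉⟨b⟩ (pos 0 , 2a≡0)

  Annihilates : ℕ → Set
  Annihilates n = 0 ℕ.< n × n ×ₙ a ≡ 0#

  some-annihilator : ∃ Annihilates
  some-annihilator with Fin.pigeonhole (ℕ.n<1+n size) (λ i → Injection.to encoding (toℕ i ×ₙ a))
  ... | i , j , i<j , same = toℕ j ℕ.∸ toℕ i , ℕ.m<n⇒0<n∸m i<j
                           , ×ₙ-∸-annihilates a (ℕ.<⇒≤ i<j) (Injection.injective encoding same)

  order-of-a : LeastWitness Annihilates
  order-of-a = least-witness (λ n → (0 ℕ.<? n) ×-dec ((n ×ₙ a) ≟ 0#)) _ (proj₂ some-annihilator)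

  order : ℕ
  order = proj₁ order-of-a

  0<order : 0 ℕ.< order
  0<order = proj₁ (proj₁ (proj₂ order-of-a))

  order-annihilates : order ×ₙ a ≡ 0#
  order-annihilates = proj₂ (proj₁ (proj₂ order-of-a))

  no-collision-below-order : ∀ {k j} → k ℕ.< j → j ℕ.< order → k ×ₙ a ≢ j ×ₙ a
  no-collision-below-order {k} {j} k<j j<o ka≡ja =
    proj₂ (proj₂ order-of-a) (ℕ.≤-<-trans (ℕ.m∸n≤m j k) j<o)
      (ℕ.m<n⇒0<n∸m k<j , ×ₙ-∸-annihilates a (ℕ.<⇒≤ k<j) ka≡ja)

  ×ₙ-injective : ∀ {k j} → k ℕ.< order → j ℕ.< order → k ×ₙ a ≡ j ×ₙ a → k ≡ j
  ×ₙ-injective {k} {j} k<o j<o ka≡ja with ℕ.<-cmp k j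
  ... | tri≈ _ k≡j _ = k≡j
  ... | tri< k<j _ _ = ⊥-elim (no-collision-below-order k<j j<o ka≡ja)
  ... | tri> _ _ j<k = ⊥-elim (no-collision-below-order j<k k<o (sym ka≡ja))

  2≤order : 2 ℕ.≤ order
  2≤order with order | 0<order | order-annihilates
  ... | suc zero    | _ | a+0≡0 = ⊥-elim (2a≢0 (trans (cong₂ _+_ a≡0 a≡0) (identityʳ 0#)))
    where a≡0 = trans (sym (identityʳ a)) a+0≡0
  ... | suc (suc _) | _ | _     = ℕ.s≤s (ℕ.s≤s ℕ.z≤n)

  coset : ℕ → Carrier
  coset k = k ×ₙ a + b

  double-coset∉⟨a⟩ : ∀ k → ¬ InCyclic G a (coset k + coset k)
  double-coset∉⟨a⟩ k 2c∈ =
    2b∉⟨a⟩ (InCyclic-cancelˡ (InCyclic-+ ka∈ ka∈) (subst (InCyclic G a) (interchange _ _ _ _) 2c∈))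
    where ka∈ = InCyclic-×ₙ k a

  coset-next : ∀ (i : Fin order) → coset (toℕ (next i)) ≡ a + coset (toℕ i)
  coset-next i with toℕ-next i
  ... | inj₁ next≡1+i          = trans (cong coset next≡1+i) (assoc _ _ _)
  ... | inj₂ (next≡0 , 1+i≡o) = begin
    coset (toℕ (next i))       ≡⟨ cong coset next≡0 ⟩
    0# + b                     ≡⟨ cong (_+ b) order-annihilates ⟨
    order ×ₙ a + b             ≡⟨ cong (λ k → k ×ₙ a + b) 1+i≡o ⟨
    (a + toℕ i ×ₙ a) + b       ≡⟨ assoc _ _ _ ⟩
    a + coset (toℕ i)          ∎
    where open ≡-Reasoning

  vertexAt : Fin order → Vertex G
  vertexAt i = vertex a (coset (toℕ i))
    (Validity.isVertexPair G a _ 2a≢0 (double-coset∉⟨a⟩ (toℕ i)))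

  edgeAt : Fin order → Edge G
  edgeAt i = edge a (coset (toℕ i))
    (Validity.isEdgePair G a _ 2a≢0 (double-coset∉⟨a⟩ (toℕ i)))

  module Separation (i j : Fin order) (i≢j : i ≢ j) (t : Carrier) where
    open Impossibility G a b (toℕ i ×ₙ a) (toℕ j ×ₙ a) t 2a∉⟨b⟩ 2b∉⟨a⟩
      (InCyclic-×ₙ (toℕ i) a) (InCyclic-×ₙ (toℕ j) a)
      (i≢j ∘ Fin.toℕ-injective ∘ ×ₙ-injective (Fin.toℕ<n i) (Fin.toℕ<n j))
    open Certificates generators impossible? impossible-sound

    α γ γ′ τ : Term 4
    α  = var zero
    γ  = var (suc zero)
    γ′ = var (suc (suc zero))
    τ  = var (suc (suc (suc zero)))

    vertex-⊈-translate : ¬ _⊆ₛ_ G (vset G (vertexAt j)) (translate G t (vset G (vertexAt i)))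
    vertex-⊈-translate = ⊈-by-certificate (0ₜ ∷ α ∷ γ′ ∷ []) (0ₜ +ₜ τ ∷ α +ₜ τ ∷ γ +ₜ τ ∷ []) _

    vertex-⊈-reflect : ¬ _⊆ₛ_ G (vset G (vertexAt j)) (reflectTranslate G t (vset G (vertexAt i)))
    vertex-⊈-reflect =
      ⊈-by-certificate (0ₜ ∷ α ∷ γ′ ∷ []) (-ₜ 0ₜ +ₜ τ ∷ -ₜ α +ₜ τ ∷ -ₜ γ +ₜ τ ∷ []) _

    edge-⊈-translate : ¬ _⊆ₛ_ G (eset G (edgeAt j)) (translate G t (eset G (edgeAt i)))
    edge-⊈-translate = ⊈-by-certificate (0ₜ ∷ α ∷ γ′ ∷ α +ₜ γ′ ∷ [])
      (0ₜ +ₜ τ ∷ α +ₜ τ ∷ γ +ₜ τ ∷ (α +ₜ γ) +ₜ τ ∷ []) _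

    edge-⊈-reflect : ¬ _⊆ₛ_ G (eset G (edgeAt j)) (reflectTranslate G t (eset G (edgeAt i)))
    edge-⊈-reflect = ⊈-by-certificate (0ₜ ∷ α ∷ γ′ ∷ α +ₜ γ′ ∷ [])
      (-ₜ 0ₜ +ₜ τ ∷ -ₜ α +ₜ τ ∷ -ₜ γ +ₜ τ ∷ -ₜ (α +ₜ γ) +ₜ τ ∷ []) _

  vertices-distinct : ∀ i j → i ≢ j → ¬ SameVertex G (vertexAt i) (vertexAt j)
  vertices-distinct i j i≢j (t , inj₁ same) = Separation.vertex-⊈-translate i j i≢j t (≐⇒⊆ same)
  vertices-distinct i j i≢j (t , inj₂ same) = Separation.vertex-⊈-reflect i j i≢j t (≐⇒⊆ same)

  edges-distinct : ∀ i j → i ≢ j → ¬ SameEdge G (edgeAt i) (edgeAt j)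
  edges-distinct i j i≢j (t , inj₁ same) = Separation.edge-⊈-translate i j i≢j t (≐⇒⊆ same)
  edges-distinct i j i≢j (t , inj₂ same) = Separation.edge-⊈-reflect i j i≢j t (≐⇒⊆ same)

  vertex⊆edge : ∀ i → _⊆ₛ_ G (vset G (vertexAt i)) (eset G (edgeAt i))
  vertex⊆edge i x = ∈-++⁺ˡ

  next-vertex⊆edge : ∀ i → _⊆ₛ_ G (vset G (vertexAt (next i))) (eset G (edgeAt i))
  next-vertex⊆edge i x (here x≡0)                = here x≡0
  next-vertex⊆edge i x (there (here x≡a))        = there (here x≡a)
  next-vertex⊆edge i x (there (there (here x≡c))) = there (there (there (here (trans x≡c (coset-next i)))))

  cycle : Cycle G
  cycle = record
    { len          = order
    ; len≥2        = 2≤order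
    ; vtx          = vertexAt
    ; edg          = edgeAt
    ; vtx-distinct = vertices-distinct
    ; edg-distinct = edges-distinct
    ; edg-left     = λ i → vset G (vertexAt i) , InOrbit-refl _ , vertex⊆edge i
    ; edg-right    = λ i → vset G (vertexAt (next i)) , InOrbit-refl _ , next-vertex⊆edge i
    }

  cycle-contains-[a,b,a+b] : CycleContains G cycle a b
  cycle-contains-[a,b,a+b] = first , subst (InOrbit G (eset G (edgeAt first)))
      (cong (λ c → base G (a ∷ c ∷ a + c ∷ [])) coset≡b) (InOrbit-refl _)
    where
    first : Fin order
    first = fromℕ< 0<order
    coset≡b : coset (toℕ first) ≡ b
    coset≡b = trans (cong coset (Fin.toℕ-fromℕ< 0<order)) (identityˡ b)

lemma3p9 : (G : FiniteAbelianGroup) (a b : FiniteAbelianGroup.Carrier G)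
    → ¬ InCyclic G b (FiniteAbelianGroup._+_ G a a)
    → ¬ InCyclic G a (FiniteAbelianGroup._+_ G b b)
    → Σ (Cycle G) (λ C → CycleContains G C a b)
lemma3p9 G a b 2a∉⟨b⟩ 2b∉⟨a⟩ = cycle , cycle-contains-[a,b,a+b]
  where open KöhlerCycle G a b 2a∉⟨b⟩ 2b∉⟨a⟩
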